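{- For every integer $h\ge2$ there exist a constant $c=c(h)$ and $n_0$ such that for all $n\ge n_0$ the following holds. Let $H$ be a red-blue graph on $h$ vertices and let $G$ be a red-blue $K_n$ with $\#(H,G)=\max(H,n)$. Then every vertex of $G$ lies in $\left(1\pm\frac cn\right)\frac{h\cdot\max(H,n)}{n}$ copies of $H$ in $G$.
   Context: A red-blue graph has each edge coloured red or blue; a red-blue $K_n$ is such a colouring of the complete graph on $n$ vertices. $\#(H,G)$ is the number of copies of $H$ in $G$ (subgraphs isomorphic to $H$ by a colour-preserving isomorphism), and $\max(H,n)$ is the maximum of $\#(H,G)$ over all red-blue $K_n$. The notation $a\pm b$ denotes a quantity in $[a-b,a+b]$. -}

module Defs where

open import Data.Nat using (ℕ; zero; suc; _≤_)
open import Data.Bool using (Bool; true; false; _∧_; _∨_; not)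
open import Data.Fin using (Fin; _≟_)
open import Data.Maybe using (Maybe; just; nothing; is-just)
open import Data.Vec using (Vec; []; _∷_; lookup; tabulate)
open import Data.List using (List; [_]; map; concatMap; filterᵇ; length; allFin; deduplicateᵇ)
open import Data.Product using (_×_; _,_; proj₁)
open import Data.Bool.ListAction using (any; all)
open import Relation.Nullary.Decidable using (⌊_⌋)
open import Relation.Binary.PropositionalEquality using (_≡_)

data Colour : Set where
  red blue : Colour

_==ᶜ_ : Colour → Colour → Bool
red  ==ᶜ red  = true
blue ==ᶜ blue = true
_    ==ᶜ _    = false

RBGraph : ℕ → Set
RBGraph h = Fin h → Fin h → Maybe Colour

IsRBGraph : ∀ {h} → RBGraph h → Set
IsRBGraph {h} H = (∀ i j → H i j ≡ H j i) × (∀ i → H i i ≡ nothing)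

-- A red-blue K_n: every pair of distinct vertices gets a colour.
-- Well-formedness: symmetric (diagonal values are irrelevant, never used).
RBComplete : ℕ → Set
RBComplete n = Fin n → Fin n → Colour

IsRBComplete : ∀ {n} → RBComplete n → Set
IsRBComplete {n} G = ∀ u v → G u v ≡ G v u

_==ᶠ_ : ∀ {n} → Fin n → Fin n → Bool
a ==ᶠ b = ⌊ a ≟ b ⌋

anyFin : ∀ {h} → (Fin h → Bool) → Bool
anyFin {h} p = any p (allFin h)

allFin? : ∀ {h} → (Fin h → Bool) → Bool
allFin? {h} p = all p (allFin h)

allMaps : ∀ h n → List (Vec (Fin n) h)
allMaps zero    n = [ [] ]
allMaps (suc h) n = concatMap (λ x → map (x ∷_) (allMaps h n)) (allFin n)

isEmbedding : ∀ {h n} → RBGraph h → RBComplete n → Vec (Fin n) h → Bool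
isEmbedding H G f =
  allFin? (λ i → allFin? (λ j →
      ((i ==ᶠ j) ∨ not (lookup f i ==ᶠ lookup f j)) ∧ edgeOK i j))
  where
  edgeOK : _ → _ → Bool
  edgeOK i j with H i j
  ... | nothing = true
  ... | just c  = G (lookup f i) (lookup f j) ==ᶜ c

-- A subgraph of G (with colours inherited from G) is determined by its
-- vertex set and its edge set, both encoded as Boolean vectors.
Subgraph : ℕ → Set
Subgraph n = Vec Bool n × Vec (Vec Bool n) n

image : ∀ {h n} → RBGraph h → Vec (Fin n) h → Subgraph n
image H f =
  ( tabulate (λ u → anyFin (λ i → lookup f i ==ᶠ u))
  , tabulate (λ u → tabulate (λ w →
      anyFin (λ i → anyFin (λ j →
        (lookup f i ==ᶠ u) ∧ (lookup f j ==ᶠ w) ∧ is-just (H i j))))) )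

_==ᵇ_ : Bool → Bool → Bool
true  ==ᵇ b = b
false ==ᵇ b = not b

eqVec : ∀ {A : Set} {m} → (A → A → Bool) → Vec A m → Vec A m → Bool
eqVec e []       []       = true
eqVec e (x ∷ xs) (y ∷ ys) = e x y ∧ eqVec e xs ys

eqSub : ∀ {n} → Subgraph n → Subgraph n → Bool
eqSub (V , E) (V' , E') = eqVec _==ᵇ_ V V' ∧ eqVec (eqVec _==ᵇ_) E E'

-- The copies of H in G: the distinct subgraphs of G that are isomorphic
-- to H by a colour-preserving isomorphism, i.e. images of embeddings.
copies : ∀ {h n} → RBGraph h → RBComplete n → List (Subgraph n)
copies {h} {n} H G =
  deduplicateᵇ eqSub (map (image H) (filterᵇ (isEmbedding H G) (allMaps h n)))

#copies : ∀ {h n} → RBGraph h → RBComplete n → ℕ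
#copies H G = length (copies H G)

#copiesAt : ∀ {h n} → RBGraph h → RBComplete n → Fin n → ℕ
#copiesAt H G v = length (filterᵇ (λ S → lookup (proj₁ S) v) (copies H G))

IsMaximiser : ∀ {h n} → RBGraph h → RBComplete n → Set
IsMaximiser {h} {n} H G =
  IsRBComplete G × (∀ (G' : RBComplete n) → IsRBComplete G' → #copies H G' ≤ #copies H G)

-- Write d(v) for the number of copies of H through v. Double counting gives
-- Σ_v d(v) = h·#(H,G). If G is a maximiser and u ≠ v, make v a twin of u: the
-- copies avoiding v survive, and those through u but not v reappear with v in
-- place of u, so maximality gives d(u) ≤ d(v) + d(u,v). The codegree d(u,v) is at
-- most the number h(h−1)n^(h−2) of maps Fin h → Fin n hitting both u and v, so
-- every degree is within h(h−1)n^(h−2) of the mean h·#(H,G)/n. Finally a balanced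
-- blow-up of H has at least (n/h)^h ≥ n^h/(2h)^h copies, hence
-- n²·h(h−1)n^(h−2) ≤ c·h·#(H,G) with c = (h−1)(2h)^h, which turns the additive
-- error into the multiplicative one.

module Submission where

open import Defs
open import Data.Nat using (ℕ; zero; suc; _+_; _*_; _≤_; _^_; _/_; _%_; z≤n; s≤s; NonZero)
open import Data.Nat.Properties hiding (_≟_; suc-injective; 0≢1+n)
open import Data.Nat.DivMod using (_mod_; [m+kn]%n≡m%n; m<n⇒m%n≡m; m≡m%n+[m/n]*n; m%n<n; m≥n⇒m/n>0; m/n*n≤m)
open import Data.Nat.Tactic.RingSolver using (solve-∀)
open import Algebra.Properties.CommutativeSemigroup +-commutativeSemigroup using (interchange)
open import Algebra.Properties.Semiring.Sum +-*-semiring using (sum; sum-syntax; ∑-distrib-+; sum-cong-≗; *-distribʳ-sum)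
open import Data.Bool using (Bool; true; false; _∧_; _∨_; not; T)
open import Data.Bool.Properties using (T-∧)
open import Data.Bool.ListAction using (all; or)
open import Data.Empty using (⊥)
open import Data.Fin using (Fin; zero; suc; _≟_; toℕ; fromℕ<)
open import Data.Fin.Properties using (suc-injective; 0≢1+n; toℕ<n; toℕ-fromℕ<; toℕ-injective)
open import Data.Fin.Permutation.Components using (transpose; transpose-inverse)
open import Data.List
  using (List; []; _∷_; _++_; map; concatMap; tabulate; allFin; cartesianProductWith; filterᵇ; deduplicateᵇ; length)
open import Data.List.Properties using (length-++; length-map; filter-++; filter-all; map-tabulate; map-cong)
open import Data.List.Membership.Propositional using (_∈_; lose)
open import Data.List.Membership.Propositional.Properties
  using (∈-++⁻; ∈-++⁺ˡ; ∈-++⁺ʳ; ∈-∃++; ∈-allFin; ∈-cartesianProductWith⁺; ∈-map⁺; ∈-map⁻; ∈-filter⁺; ∈-filter⁻; ∈-deduplicate⁻)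
open import Data.List.Relation.Unary.All as All using ([]; _∷_)
open import Data.List.Relation.Unary.All.Properties using (all⁺; all-filter)
open import Data.List.Relation.Unary.Any using (here; there; satisfied)
open import Data.List.Relation.Unary.Any.Properties using (any⁺; any⁻; deduplicate⁺)
open import Data.List.Relation.Unary.Unique.Propositional using (Unique; []; _∷_)
open import Data.List.Relation.Unary.Unique.Propositional.Properties
  using (cartesianProductWith⁺; allFin⁺; filter⁺; map⁺; ++⁺)
open import Data.Maybe using (just; nothing; is-just; fromMaybe)
open import Data.Product using (Σ; ∃; _×_; _,_; proj₁; proj₂; uncurry)
open import Data.Sum using (inj₁; inj₂)
open import Data.Vec using (Vec; []; _∷_; lookup)
import Data.Vec as V
open import Data.Vec.Properties using (∷-injective; lookup∘tabulate; tabulate∘lookup; tabulate-cong; lookup-map)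
open import Function using (_∘_; const; id; case_of_)
open import Function.Bundles using (_⇔_; mk⇔; module Equivalence)
open import Function.Definitions using (Injective)
open import Relation.Nullary using (¬_; ¬?; Dec; does; contradiction; yes; no)
open import Relation.Nullary.Decidable using (T?; ⌊⌋-map′; toWitness; fromWitness; dec-true; dec-false)
open import Relation.Binary.PropositionalEquality

⟦_⟧ : Bool → ℕ
⟦ true ⟧  = 1
⟦ false ⟧ = 0

⟦∨⟧-≤ : ∀ a b → ⟦ a ∨ b ⟧ ≤ ⟦ a ⟧ + ⟦ b ⟧
⟦∨⟧-≤ true  b = s≤s z≤n
⟦∨⟧-≤ false b = ≤-refl

⟦∨⟧-disjoint : ∀ a b → (T a → ¬ T b) → ⟦ a ∨ b ⟧ ≡ ⟦ a ⟧ + ⟦ b ⟧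
⟦∨⟧-disjoint true  true  a⇒¬b = contradiction _ (a⇒¬b _)
⟦∨⟧-disjoint true  false _    = refl
⟦∨⟧-disjoint false b     _    = refl

⟦∨∧∨⟧-≤ : ∀ a b p q → (T a → ¬ T b) → ⟦ (a ∨ p) ∧ (b ∨ q) ⟧ ≤ ⟦ (a ∧ q) ∨ (b ∧ p) ⟧ + ⟦ p ∧ q ⟧
⟦∨∧∨⟧-≤ true  true  p q a⇒¬b = contradiction _ (a⇒¬b _)
⟦∨∧∨⟧-≤ true  false p     true  _    = s≤s z≤n
⟦∨∧∨⟧-≤ true  false p     false _    = z≤n
⟦∨∧∨⟧-≤ false true  true  q     _    = s≤s z≤n
⟦∨∧∨⟧-≤ false true  false q     _    = z≤n
⟦∨∧∨⟧-≤ false false p     q     _    = ≤-refl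

T-not⇒¬T : ∀ {b} → T (not b) → ¬ T b
T-not⇒¬T {true} ()

==ᶠ-cong-⇔ : ∀ {n} {a b c d : Fin n} → (a ≡ b ⇔ c ≡ d) → (a ==ᶠ b) ≡ (c ==ᶠ d)
==ᶠ-cong-⇔ {a = a} {b} {c} {d} a≡b⇔c≡d with a ≟ b | c ≟ d
... | yes _   | yes _   = refl
... | no _    | no _    = refl
... | yes a≡b | no c≢d  = contradiction (Equivalence.to a≡b⇔c≡d a≡b) c≢d
... | no a≢b  | yes c≡d = contradiction (Equivalence.from a≡b⇔c≡d c≡d) a≢b

module _ {h : ℕ} (p : Fin h → Bool) where

  anyFin⁺ : ∀ i → T (p i) → T (anyFin p)
  anyFin⁺ i pᵢ = any⁺ p (lose (∈-allFin i) pᵢ)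

  anyFin⁻ : T (anyFin p) → ∃ λ i → T (p i)
  anyFin⁻ t = satisfied (any⁻ p (allFin h) t)

  allFin?⁻ : T (allFin? p) → ∀ i → T (p i)
  allFin?⁻ t i = All.lookup (all⁺ p (allFin h) t) (∈-allFin i)

  allFin?-false : allFin? p ≡ false → ∃ λ i → p i ≡ false
  allFin?-false = go (allFin h)
    where
    go : ∀ is → all p is ≡ false → ∃ λ i → p i ≡ false
    go (i ∷ is) eq with p i in pᵢ
    ... | false = i , pᵢ
    ... | true  = go is eq

anyFin-suc : ∀ {h} (p : Fin (suc h) → Bool) → anyFin p ≡ p zero ∨ anyFin (p ∘ suc)
anyFin-suc p = trans (cong or (map-tabulate id p)) (cong (p zero ∨_) (sym (cong or (map-tabulate id (p ∘ suc)))))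

anyFin-cong : ∀ {h} {p q : Fin h → Bool} → p ≗ q → anyFin p ≡ anyFin q
anyFin-cong p≗q = cong or (map-cong p≗q (allFin _))

countᵇ : ∀ {A : Set} → (A → Bool) → List A → ℕ
countᵇ p = length ∘ filterᵇ p

module _ {A : Set} where

  countᵇ-∷ : ∀ (p : A → Bool) x xs → countᵇ p (x ∷ xs) ≡ ⟦ p x ⟧ + countᵇ p xs
  countᵇ-∷ p x xs with p x
  ... | true  = refl
  ... | false = refl

  countᵇ-++ : ∀ (p : A → Bool) xs ys → countᵇ p (xs ++ ys) ≡ countᵇ p xs + countᵇ p ys
  countᵇ-++ p xs ys = trans (cong length (filter-++ (T? ∘ p) xs ys)) (length-++ (filterᵇ p xs))

  countᵇ-const-true : ∀ (xs : List A) → countᵇ (const true) xs ≡ length xs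
  countᵇ-const-true xs = cong length (filter-all _ (All.universal _ xs))

  countᵇ-≗ : ∀ {p q : A → Bool} → p ≗ q → ∀ xs → countᵇ p xs ≡ countᵇ q xs
  countᵇ-≗ {p} {q} p≗q []       = refl
  countᵇ-≗ {p} {q} p≗q (x ∷ xs) =
    trans (countᵇ-∷ p x xs) (trans (cong₂ _+_ (cong ⟦_⟧ (p≗q x)) (countᵇ-≗ p≗q xs)) (sym (countᵇ-∷ q x xs)))

  countᵇ-const : ∀ b (xs : List A) → countᵇ (const b) xs ≡ ⟦ b ⟧ * length xs
  countᵇ-const true  xs = trans (countᵇ-const-true xs) (sym (+-identityʳ _))
  countᵇ-const false []       = refl
  countᵇ-const false (x ∷ xs) = countᵇ-const false xs

  countᵇ-∧ˡ : ∀ b (p : A → Bool) xs → countᵇ (λ x → b ∧ p x) xs ≡ ⟦ b ⟧ * countᵇ p xs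
  countᵇ-∧ˡ true  p xs = sym (+-identityʳ _)
  countᵇ-∧ˡ false p xs = countᵇ-const false xs

  countᵇ-≤-+ : ∀ (p q r : A → Bool) → (∀ x → ⟦ p x ⟧ ≤ ⟦ q x ⟧ + ⟦ r x ⟧) →
               ∀ xs → countᵇ p xs ≤ countᵇ q xs + countᵇ r xs
  countᵇ-≤-+ p q r pqr []       = z≤n
  countᵇ-≤-+ p q r pqr (x ∷ xs) = begin
    countᵇ p (x ∷ xs)                                 ≡⟨ countᵇ-∷ p x xs ⟩
    ⟦ p x ⟧ + countᵇ p xs                              ≤⟨ +-mono-≤ (pqr x) (countᵇ-≤-+ p q r pqr xs) ⟩
    (⟦ q x ⟧ + ⟦ r x ⟧) + (countᵇ q xs + countᵇ r xs)  ≡⟨ interchange ⟦ q x ⟧ ⟦ r x ⟧ _ _ ⟩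
    (⟦ q x ⟧ + countᵇ q xs) + (⟦ r x ⟧ + countᵇ r xs)  ≡⟨ cong₂ _+_ (countᵇ-∷ q x xs) (countᵇ-∷ r x xs) ⟨
    countᵇ q (x ∷ xs) + countᵇ r (x ∷ xs)             ∎
    where open ≤-Reasoning

  countᵇ-split : ∀ (p q : A → Bool) xs →
                 countᵇ p xs ≡ countᵇ (λ x → p x ∧ q x) xs + countᵇ (λ x → p x ∧ not (q x)) xs
  countᵇ-split p q []       = refl
  countᵇ-split p q (x ∷ xs)
    rewrite countᵇ-∷ p x xs | countᵇ-∷ (λ x → p x ∧ q x) x xs
          | countᵇ-∷ (λ x → p x ∧ not (q x)) x xs | countᵇ-split p q xs
    with p x | q x
  ... | true  | true  = refl
  ... | true  | false = sym (+-suc _ _)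
  ... | false | _     = refl

module _ {A B : Set} where

  countᵇ-map : ∀ (p : B → Bool) (f : A → B) xs → countᵇ p (map f xs) ≡ countᵇ (p ∘ f) xs
  countᵇ-map p f []       = refl
  countᵇ-map p f (x ∷ xs) = begin
    countᵇ p (f x ∷ map f xs)        ≡⟨ countᵇ-∷ p (f x) (map f xs) ⟩
    ⟦ p (f x) ⟧ + countᵇ p (map f xs) ≡⟨ cong (⟦ p (f x) ⟧ +_) (countᵇ-map p f xs) ⟩
    ⟦ p (f x) ⟧ + countᵇ (p ∘ f) xs   ≡⟨ countᵇ-∷ (p ∘ f) x xs ⟨
    countᵇ (p ∘ f) (x ∷ xs)          ∎
    where open ≡-Reasoning

module _ {A : Set} where

  Unique-⊆⇒length≤ : ∀ {xs ys : List A} → Unique xs → (∀ {x} → x ∈ xs → x ∈ ys) → length xs ≤ length ys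
  Unique-⊆⇒length≤ {[]}     _          _  = z≤n
  Unique-⊆⇒length≤ {x ∷ xs} (x∉xs ∷ u) xs⊆ys with ∈-∃++ (xs⊆ys (here refl))
  ... | ys₁ , ys₂ , refl = begin
    suc (length xs)                 ≤⟨ s≤s (Unique-⊆⇒length≤ u xs⊆ys₁ys₂) ⟩
    suc (length (ys₁ ++ ys₂))       ≡⟨ cong suc (length-++ ys₁) ⟩
    suc (length ys₁ + length ys₂)   ≡⟨ +-suc (length ys₁) (length ys₂) ⟨
    length ys₁ + length (x ∷ ys₂)   ≡⟨ length-++ ys₁ ⟨
    length (ys₁ ++ x ∷ ys₂)         ∎
    where
    open ≤-Reasoning
    xs⊆ys₁ys₂ : ∀ {z} → z ∈ xs → z ∈ ys₁ ++ ys₂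
    xs⊆ys₁ys₂ z∈xs with ∈-++⁻ ys₁ (xs⊆ys (there z∈xs))
    ... | inj₁ z∈ys₁         = ∈-++⁺ˡ z∈ys₁
    ... | inj₂ (here refl)   = contradiction refl (All.lookup x∉xs z∈xs)
    ... | inj₂ (there z∈ys₂) = ∈-++⁺ʳ ys₁ z∈ys₂

∑-const : ∀ n c → ∑[ i < n ] c ≡ n * c
∑-const zero    c = refl
∑-const (suc n) c = cong (c +_) (∑-const n c)

∑-mono-≤ : ∀ {n} {f g : Fin n → ℕ} → (∀ i → f i ≤ g i) → sum f ≤ sum g
∑-mono-≤ {zero}  f≤g = z≤n
∑-mono-≤ {suc n} f≤g = +-mono-≤ (f≤g zero) (∑-mono-≤ (f≤g ∘ suc))

∑-⟦==ᶠ⟧ : ∀ {n} (x : Fin n) → ∑[ v < n ] ⟦ x ==ᶠ v ⟧ ≡ 1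
∑-⟦==ᶠ⟧ {suc n} zero    = cong suc (trans (∑-const n 0) (*-zeroʳ n))
∑-⟦==ᶠ⟧ {suc n} (suc x) =
  trans (sum-cong-≗ (λ v → cong ⟦_⟧ (⌊⌋-map′ (cong suc) suc-injective (x ≟ v)))) (∑-⟦==ᶠ⟧ x)

∑-⟦==ᶠ⟧-* : ∀ {n} (w : Fin n) c → ∑[ x < n ] (⟦ x ==ᶠ w ⟧ * c) ≡ c
∑-⟦==ᶠ⟧-* {n} w c = begin
  ∑[ x < n ] (⟦ x ==ᶠ w ⟧ * c)   ≡⟨ *-distribʳ-sum c (λ x → ⟦ x ==ᶠ w ⟧) ⟨
  ∑[ x < n ] ⟦ x ==ᶠ w ⟧ * c     ≡⟨ cong (_* c) (sum-cong-≗ {n} flip-==ᶠ) ⟩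
  ∑[ x < n ] ⟦ w ==ᶠ x ⟧ * c     ≡⟨ cong (_* c) (∑-⟦==ᶠ⟧ w) ⟩
  1 * c                         ≡⟨ *-identityˡ c ⟩
  c                             ∎
  where
  open ≡-Reasoning
  flip-==ᶠ : ∀ x → ⟦ x ==ᶠ w ⟧ ≡ ⟦ w ==ᶠ x ⟧
  flip-==ᶠ x = cong ⟦_⟧ (==ᶠ-cong-⇔ (mk⇔ sym sym))

∑-countᵇ : ∀ {A : Set} {n k} (P : Fin n → A → Bool) (xs : List A) →
           (∀ {x} → x ∈ xs → ∑[ v < n ] ⟦ P v x ⟧ ≡ k) →
           ∑[ v < n ] countᵇ (P v) xs ≡ k * length xs
∑-countᵇ {n = n} {k} P [] _ = trans (∑-const n 0) (trans (*-zeroʳ n) (sym (*-zeroʳ k)))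
∑-countᵇ {n = n} {k} P (x ∷ xs) size = begin
  ∑[ v < n ] countᵇ (P v) (x ∷ xs)                        ≡⟨ sum-cong-≗ (λ v → countᵇ-∷ (P v) x xs) ⟩
  ∑[ v < n ] (⟦ P v x ⟧ + countᵇ (P v) xs)                 ≡⟨ ∑-distrib-+ (λ v → ⟦ P v x ⟧) _ ⟩
  ∑[ v < n ] ⟦ P v x ⟧ + ∑[ v < n ] countᵇ (P v) xs
    ≡⟨ cong₂ _+_ (size (here refl)) (∑-countᵇ P xs (size ∘ there)) ⟩
  k + k * length xs                                       ≡⟨ *-suc k (length xs) ⟨
  k * length (x ∷ xs)                                     ∎
  where open ≡-Reasoning

module _ {n e : ℕ} (d : Fin n → ℕ) (close : ∀ u w → d u ≤ d w + e) (v : Fin n) where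

  *-≤-∑+ : n * d v ≤ sum d + n * e
  *-≤-∑+ = begin
    n * d v                      ≡⟨ ∑-const n (d v) ⟨
    ∑[ w < n ] d v               ≤⟨ ∑-mono-≤ (close v) ⟩
    ∑[ w < n ] (d w + e)         ≡⟨ ∑-distrib-+ d (const e) ⟩
    sum d + ∑[ w < n ] e         ≡⟨ cong (sum d +_) (∑-const n e) ⟩
    sum d + n * e                ∎
    where open ≤-Reasoning

  ∑-≤-*+ : sum d ≤ n * d v + n * e
  ∑-≤-*+ = begin
    sum d                        ≤⟨ ∑-mono-≤ (λ u → close u v) ⟩
    ∑[ u < n ] (d v + e)         ≡⟨ ∑-distrib-+ {n} (const (d v)) (const e) ⟩
    ∑[ u < n ] d v + ∑[ u < n ] e ≡⟨ cong₂ _+_ (∑-const n (d v)) (∑-const n e) ⟩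
    n * d v + n * e              ∎
    where open ≤-Reasoning

module _ {A B C : Set} where

  countᵇ-cartesianProductWith : ∀ {m} (p : C → Bool) (f : A → B → C) (g : Fin m → A) ys →
    countᵇ p (cartesianProductWith f (tabulate g) ys) ≡ ∑[ i < m ] countᵇ (p ∘ f (g i)) ys
  countᵇ-cartesianProductWith {zero}  p f g ys = refl
  countᵇ-cartesianProductWith {suc m} p f g ys = begin
    countᵇ p (map (f (g zero)) ys ++ cartesianProductWith f (tabulate (g ∘ suc)) ys)   ≡⟨ countᵇ-++ p (map (f (g zero)) ys) _ ⟩
    countᵇ p (map (f (g zero)) ys) + countᵇ p (cartesianProductWith f (tabulate (g ∘ suc)) ys)
      ≡⟨ cong₂ _+_ (countᵇ-map p (f (g zero)) ys) (countᵇ-cartesianProductWith p f (g ∘ suc) ys) ⟩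
    countᵇ (p ∘ f (g zero)) ys + ∑[ i < m ] countᵇ (p ∘ f (g (suc i))) ys               ∎
    where open ≡-Reasoning

allMaps-suc : ∀ h n → allMaps (suc h) n ≡ cartesianProductWith _∷_ (allFin n) (allMaps h n)
allMaps-suc h n = go (allFin n)
  where
  go : ∀ xs → concatMap (λ x → map (x ∷_) (allMaps h n)) xs ≡ cartesianProductWith _∷_ xs (allMaps h n)
  go []       = refl
  go (x ∷ xs) = cong (map (x ∷_) (allMaps h n) ++_) (go xs)

∈-allMaps : ∀ {h n} (f : Vec (Fin n) h) → f ∈ allMaps h n
∈-allMaps {zero}      []      = here refl
∈-allMaps {suc h} {n} (x ∷ f) rewrite allMaps-suc h n = ∈-cartesianProductWith⁺ _∷_ (∈-allFin x) (∈-allMaps f)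

allMaps-Unique : ∀ h n → Unique (allMaps h n)
allMaps-Unique zero    n = [] ∷ []
allMaps-Unique (suc h) n rewrite allMaps-suc h n =
  cartesianProductWith⁺ _∷_ ∷-injective (allFin⁺ n) (allMaps-Unique h n)

countᵇ-allMaps-suc : ∀ {h n} (p : Vec (Fin n) (suc h) → Bool) →
  countᵇ p (allMaps (suc h) n) ≡ ∑[ x < n ] countᵇ (p ∘ (x ∷_)) (allMaps h n)
countᵇ-allMaps-suc {h} {n} p rewrite allMaps-suc h n = countᵇ-cartesianProductWith p _∷_ id (allMaps h n)

length-allMaps : ∀ h n → length (allMaps h n) ≡ n ^ h
length-allMaps zero    n = refl
length-allMaps (suc h) n = begin
  length (allMaps (suc h) n)                         ≡⟨ countᵇ-const-true (allMaps (suc h) n) ⟨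
  countᵇ (const true) (allMaps (suc h) n)            ≡⟨ countᵇ-allMaps-suc {h} {n} (const true) ⟩
  ∑[ x < n ] countᵇ (const true) (allMaps h n)
    ≡⟨ sum-cong-≗ {n} (λ _ → trans (countᵇ-const-true (allMaps h n)) (length-allMaps h n)) ⟩
  ∑[ x < n ] (n ^ h)                                 ≡⟨ ∑-const n (n ^ h) ⟩
  n * n ^ h                                          ∎
  where open ≡-Reasoning

==ᶜ⇒≡ : ∀ {a b} → T (a ==ᶜ b) → a ≡ b
==ᶜ⇒≡ {red}  {red}  _ = refl
==ᶜ⇒≡ {blue} {blue} _ = refl

==ᶜ-refl : ∀ a → a ==ᶜ a ≡ true
==ᶜ-refl red  = refl
==ᶜ-refl blue = refl

module _ {n h : ℕ} where

  separated⁻ : ∀ {i j : Fin h} {a b : Fin n} → T ((i ==ᶠ j) ∨ not (a ==ᶠ b)) → a ≡ b → i ≡ j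
  separated⁻ {i} {j} {a} {b} t a≡b with i ≟ j | a ≟ b
  ... | yes i≡j | _       = i≡j
  ... | no _    | no a≢b  = contradiction a≡b a≢b

  separated⁺ : ∀ {i j : Fin h} {a b : Fin n} → (a ≡ b → i ≡ j) → (i ==ᶠ j) ∨ not (a ==ᶠ b) ≡ true
  separated⁺ {i} {j} {a} {b} a≡b⇒i≡j with i ≟ j | a ≟ b
  ... | yes _   | _       = refl
  ... | no i≢j  | yes a≡b = contradiction (a≡b⇒i≡j a≡b) i≢j
  ... | no _    | no _    = refl

record Embedding {h n} (H : RBGraph h) (G : RBComplete n) (f : Vec (Fin n) h) : Set where
  field
    injective        : Injective _≡_ _≡_ (lookup f)
    preserves-colour : ∀ {i j c} → H i j ≡ just c → G (lookup f i) (lookup f j) ≡ c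

module _ {h n} {H : RBGraph h} {G : RBComplete n} {f : Vec (Fin n) h} where

  embedding⁻ : T (isEmbedding H G f) → Embedding H G f
  embedding⁻ t = record { injective = injective ; preserves-colour = preserves-colour }
    where
    injective : Injective _≡_ _≡_ (lookup f)
    injective {i} {j} with allFin?⁻ _ (allFin?⁻ _ t i) j
    ... | entry = separated⁻ (proj₁ (Equivalence.to T-∧ entry))
    preserves-colour : ∀ {i j c} → H i j ≡ just c → G (lookup f i) (lookup f j) ≡ c
    preserves-colour {i} {j} Hij with allFin?⁻ _ (allFin?⁻ _ t i) j
    ... | entry with H i j
    preserves-colour refl | entry | just c = ==ᶜ⇒≡ (proj₂ (Equivalence.to T-∧ entry))

  -- The colour test inside isEmbedding is a local with-function of Defs that cannot
  -- be named here, so we refute a failing entry, where `with H i j` reaches it.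
  embedding⁺ : Embedding H G f → T (isEmbedding H G f)
  embedding⁺ e with isEmbedding H G f in isEmb
  ... | true  = _
  ... | false with allFin?-false _ isEmb
  ... | i , rowᵢ with allFin?-false _ rowᵢ
  ... | j , entry with H i j in Hij
  ... | nothing = case trans (sym entry) (cong (_∧ true) (separated⁺ (Embedding.injective e))) of λ ()
  ... | just c  = case trans (sym entry) (cong₂ _∧_ (separated⁺ (Embedding.injective e)) colour-ok) of λ ()
    where
    colour-ok : G (lookup f i) (lookup f j) ==ᶜ c ≡ true
    colour-ok = trans (cong (_==ᶜ c) (Embedding.preserves-colour e Hij)) (==ᶜ-refl c)

module _ {A : Set} {_≈ᵇ_ : A → A → Bool} where

  eqVec-sound : (∀ {a b} → T (a ≈ᵇ b) → a ≡ b) → ∀ {m} {xs ys : Vec A m} → T (eqVec _≈ᵇ_ xs ys) → xs ≡ ys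
  eqVec-sound sound {xs = []}     {[]}     _ = refl
  eqVec-sound sound {xs = x ∷ xs} {y ∷ ys} t with Equivalence.to T-∧ t
  ... | x≈y , xs≈ys = cong₂ _∷_ (sound x≈y) (eqVec-sound sound xs≈ys)

  eqVec-refl : (∀ a → T (a ≈ᵇ a)) → ∀ {m} (xs : Vec A m) → T (eqVec _≈ᵇ_ xs xs)
  eqVec-refl refl′ []       = _
  eqVec-refl refl′ (x ∷ xs) = Equivalence.from T-∧ (refl′ x , eqVec-refl refl′ xs)

==ᵇ-sound : ∀ {a b} → T (a ==ᵇ b) → a ≡ b
==ᵇ-sound {true}  {true}  _ = refl
==ᵇ-sound {false} {false} _ = refl

==ᵇ-refl : ∀ a → T (a ==ᵇ a)
==ᵇ-refl true  = _
==ᵇ-refl false = _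

module _ {n : ℕ} where

  eqSub-sound : ∀ {S S′ : Subgraph n} → T (eqSub S S′) → S ≡ S′
  eqSub-sound {V , E} {V′ , E′} t with Equivalence.to T-∧ t
  ... | V≈V′ , E≈E′ = cong₂ _,_ (eqVec-sound ==ᵇ-sound V≈V′) (eqVec-sound (eqVec-sound ==ᵇ-sound) E≈E′)

  eqSub-refl : ∀ (S : Subgraph n) → T (eqSub S S)
  eqSub-refl (V , E) = Equivalence.from T-∧ (eqVec-refl ==ᵇ-refl V , eqVec-refl (eqVec-refl ==ᵇ-refl) E)

  deduplicateᵇ-eqSub-Unique : ∀ (Ss : List (Subgraph n)) → Unique (deduplicateᵇ eqSub Ss)
  deduplicateᵇ-eqSub-Unique []       = []
  deduplicateᵇ-eqSub-Unique (S ∷ Ss) =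
    All.map (λ S≉S′ S≡S′ → S≉S′ (subst (T ∘ eqSub S) S≡S′ (eqSub-refl S))) (all-filter S≉? (deduplicateᵇ eqSub Ss))
    ∷ filter⁺ S≉? (deduplicateᵇ-eqSub-Unique Ss)
    where
    S≉? : ∀ S′ → Dec (¬ T (eqSub S S′))
    S≉? S′ = ¬? (T? (eqSub S S′))

module _ {h n} (H : RBGraph h) (G : RBComplete n) where

  copies-Unique : Unique (copies H G)
  copies-Unique = deduplicateᵇ-eqSub-Unique _

  ∈-copies⁺ : ∀ {f} → Embedding H G f → image H f ∈ copies H G
  ∈-copies⁺ {f} e = deduplicate⁺ _ (λ S′≈S S≡f → trans S≡f (sym (eqSub-sound S′≈S)))
    (∈-map⁺ (image H) (∈-filter⁺ (T? ∘ isEmbedding H G) {xs = allMaps h n} (∈-allMaps f) (embedding⁺ e)))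

  ∈-copies⁻ : ∀ {S} → S ∈ copies H G → ∃ λ f → Embedding H G f × image H f ≡ S
  ∈-copies⁻ S∈ with ∈-map⁻ (image H) (∈-deduplicate⁻ _ _ S∈)
  ... | f , f∈ , refl = f , embedding⁻ (proj₂ (∈-filter⁻ (T? ∘ isEmbedding H G) {xs = allMaps h n} f∈)) , refl

Embedding-transfer : ∀ {h n} {H : RBGraph h} {G G′ : RBComplete n} {f g : Vec (Fin n) h} → Embedding H G f →
  (∀ {i j} → lookup g i ≡ lookup g j → lookup f i ≡ lookup f j) →
  (∀ i j → G′ (lookup g i) (lookup g j) ≡ G (lookup f i) (lookup f j)) → Embedding H G′ g
Embedding-transfer e g-collapses⇒f-collapses same-colours = record
  { injective        = Embedding.injective e ∘ g-collapses⇒f-collapses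
  ; preserves-colour = λ {i} {j} Hij → trans (same-colours i j) (Embedding.preserves-colour e Hij)
  }

-- Degrees: the number of copies through a vertex

hasVertex : ∀ {n} → Fin n → Subgraph n → Bool
hasVertex v S = lookup (proj₁ S) v

occurs : ∀ {h n} → Fin n → Vec (Fin n) h → Bool
occurs v f = anyFin (λ i → lookup f i ==ᶠ v)

module _ {h n : ℕ} where

  hasVertex-image : ∀ (H : RBGraph h) (f : Vec (Fin n) h) v → hasVertex v (image H f) ≡ occurs v f
  hasVertex-image H f v = lookup∘tabulate _ v

  occurs⁺ : ∀ {v} (f : Vec (Fin n) h) i → lookup f i ≡ v → T (occurs v f)
  occurs⁺ f i fᵢ≡v = anyFin⁺ _ i (fromWitness fᵢ≡v)

  occurs⁻ : ∀ {v} (f : Vec (Fin n) h) → T (occurs v f) → ∃ λ i → lookup f i ≡ v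
  occurs⁻ f t with anyFin⁻ _ t
  ... | i , fᵢ==v = i , toWitness fᵢ==v

occurs-∷ : ∀ {h n} v x (f : Vec (Fin n) h) → occurs v (x ∷ f) ≡ (x ==ᶠ v) ∨ occurs v f
occurs-∷ v x f = anyFin-suc (λ i → lookup (x ∷ f) i ==ᶠ v)

∑-occurs : ∀ {h n} (f : Vec (Fin n) h) → Injective _≡_ _≡_ (lookup f) → ∑[ v < n ] ⟦ occurs v f ⟧ ≡ h
∑-occurs {n = n} []      _   = trans (∑-const n 0) (*-zeroʳ n)
∑-occurs {n = n} (x ∷ f) inj = begin
  ∑[ v < n ] ⟦ occurs v (x ∷ f) ⟧                      ≡⟨ sum-cong-≗ (λ v → cong ⟦_⟧ (occurs-∷ v x f)) ⟩
  ∑[ v < n ] ⟦ (x ==ᶠ v) ∨ occurs v f ⟧                 ≡⟨ sum-cong-≗ (λ v → ⟦∨⟧-disjoint _ _ (x∉f v)) ⟩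
  ∑[ v < n ] (⟦ x ==ᶠ v ⟧ + ⟦ occurs v f ⟧)              ≡⟨ ∑-distrib-+ (λ v → ⟦ x ==ᶠ v ⟧) _ ⟩
  ∑[ v < n ] ⟦ x ==ᶠ v ⟧ + ∑[ v < n ] ⟦ occurs v f ⟧
    ≡⟨ cong₂ _+_ (∑-⟦==ᶠ⟧ x) (∑-occurs f (suc-injective ∘ inj)) ⟩
  suc _                                                ∎
  where
  open ≡-Reasoning
  x∉f : ∀ v → T (x ==ᶠ v) → ¬ T (occurs v f)
  x∉f v x==v v∈f with occurs⁻ f v∈f
  ... | i , fᵢ≡v = 0≢1+n (inj (trans (toWitness x==v) (sym fᵢ≡v)))

∑-#copiesAt : ∀ {h n} (H : RBGraph h) (G : RBComplete n) → ∑[ v < n ] #copiesAt H G v ≡ h * #copies H G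
∑-#copiesAt {h} {n} H G = ∑-countᵇ hasVertex (copies H G) size
  where
  size : ∀ {S} → S ∈ copies H G → ∑[ v < n ] ⟦ hasVertex v S ⟧ ≡ h
  size S∈ with ∈-copies⁻ H G S∈
  ... | f , e , refl = trans (sum-cong-≗ (λ v → cong ⟦_⟧ (hasVertex-image H f v))) (∑-occurs f (Embedding.injective e))

-- Codegrees: maps and copies through two vertices

#mapsThrough : ∀ h n → Fin n → ℕ
#mapsThrough h n w = countᵇ (occurs w) (allMaps h n)

#mapsThrough² : ∀ h n → Fin n → Fin n → ℕ
#mapsThrough² h n u v = countᵇ (λ f → occurs u f ∧ occurs v f) (allMaps h n)

#mapsThrough-suc : ∀ h n w → #mapsThrough (suc h) n w ≤ n ^ h + n * #mapsThrough h n w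
#mapsThrough-suc h n w = begin
  #mapsThrough (suc h) n w
    ≡⟨ countᵇ-allMaps-suc (occurs w) ⟩
  ∑[ x < n ] countᵇ (λ f → occurs w (x ∷ f)) fs
    ≡⟨ sum-cong-≗ (λ x → countᵇ-≗ (λ f → occurs-∷ w x f) fs) ⟩
  ∑[ x < n ] countᵇ (λ f → (x ==ᶠ w) ∨ occurs w f) fs
    ≤⟨ ∑-mono-≤ (λ x → countᵇ-≤-+ _ (const (x ==ᶠ w)) (occurs w) (λ f → ⟦∨⟧-≤ (x ==ᶠ w) (occurs w f)) fs) ⟩
  ∑[ x < n ] (countᵇ (const (x ==ᶠ w)) fs + #mapsThrough h n w)
    ≡⟨ ∑-distrib-+ (λ x → countᵇ (const (x ==ᶠ w)) fs) _ ⟩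
  ∑[ x < n ] countᵇ (const (x ==ᶠ w)) fs + ∑[ x < n ] #mapsThrough h n w
    ≡⟨ cong₂ _+_ (trans (sum-cong-≗ (λ x → countᵇ-const (x ==ᶠ w) fs)) (∑-⟦==ᶠ⟧-* w (length fs)))
                 (∑-const n (#mapsThrough h n w)) ⟩
  length fs + n * #mapsThrough h n w
    ≡⟨ cong (_+ n * #mapsThrough h n w) (length-allMaps h n) ⟩
  n ^ h + n * #mapsThrough h n w ∎
  where
  open ≤-Reasoning
  fs : List (Vec (Fin n) h)
  fs = allMaps h n

-- Split on the first value x: if x = u the rest must hit v, if x = v it must hit u,
-- and otherwise it must hit both.
#mapsThrough²-suc : ∀ h n {u v} → u ≢ v →
  #mapsThrough² (suc h) n u v ≤ #mapsThrough h n v + #mapsThrough h n u + n * #mapsThrough² h n u v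
#mapsThrough²-suc h n {u} {v} u≢v = begin
  #mapsThrough² (suc h) n u v
    ≡⟨ countᵇ-allMaps-suc (λ f → occurs u f ∧ occurs v f) ⟩
  ∑[ x < n ] countᵇ (λ f → occurs u (x ∷ f) ∧ occurs v (x ∷ f)) fs
    ≡⟨ sum-cong-≗ (λ x → countᵇ-≗ (λ f → cong₂ _∧_ (occurs-∷ u x f) (occurs-∷ v x f)) fs) ⟩
  ∑[ x < n ] countᵇ (λ f → ((x ==ᶠ u) ∨ occurs u f) ∧ ((x ==ᶠ v) ∨ occurs v f)) fs
    ≤⟨ ∑-mono-≤ split ⟩
  ∑[ x < n ] (⟦ x ==ᶠ u ⟧ * Bᵥ + ⟦ x ==ᶠ v ⟧ * Bᵤ + A)
    ≡⟨ ∑-distrib-+ (λ x → ⟦ x ==ᶠ u ⟧ * Bᵥ + ⟦ x ==ᶠ v ⟧ * Bᵤ) (const A) ⟩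
  ∑[ x < n ] (⟦ x ==ᶠ u ⟧ * Bᵥ + ⟦ x ==ᶠ v ⟧ * Bᵤ) + ∑[ x < n ] A
    ≡⟨ cong₂ _+_ (∑-distrib-+ (λ x → ⟦ x ==ᶠ u ⟧ * Bᵥ) _) (∑-const n A) ⟩
  ∑[ x < n ] (⟦ x ==ᶠ u ⟧ * Bᵥ) + ∑[ x < n ] (⟦ x ==ᶠ v ⟧ * Bᵤ) + n * A
    ≡⟨ cong (_+ n * A) (cong₂ _+_ (∑-⟦==ᶠ⟧-* u Bᵥ) (∑-⟦==ᶠ⟧-* v Bᵤ)) ⟩
  Bᵥ + Bᵤ + n * A ∎
  where
  open ≤-Reasoning
  fs : List (Vec (Fin n) h)
  fs = allMaps h n
  Bᵤ Bᵥ A : ℕ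
  Bᵤ = #mapsThrough h n u
  Bᵥ = #mapsThrough h n v
  A  = #mapsThrough² h n u v
  split : ∀ x → countᵇ (λ f → ((x ==ᶠ u) ∨ occurs u f) ∧ ((x ==ᶠ v) ∨ occurs v f)) fs
                ≤ ⟦ x ==ᶠ u ⟧ * Bᵥ + ⟦ x ==ᶠ v ⟧ * Bᵤ + A
  split x = begin
    countᵇ (λ f → (a ∨ occurs u f) ∧ (b ∨ occurs v f)) fs
      ≤⟨ countᵇ-≤-+ _ (λ f → (a ∧ occurs v f) ∨ (b ∧ occurs u f)) _
           (λ f → ⟦∨∧∨⟧-≤ a b (occurs u f) (occurs v f) a⇒¬b) fs ⟩
    countᵇ (λ f → (a ∧ occurs v f) ∨ (b ∧ occurs u f)) fs + A
      ≤⟨ +-monoˡ-≤ A (countᵇ-≤-+ _ (λ f → a ∧ occurs v f) (λ f → b ∧ occurs u f)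
                                     (λ f → ⟦∨⟧-≤ (a ∧ occurs v f) (b ∧ occurs u f)) fs) ⟩
    countᵇ (λ f → a ∧ occurs v f) fs + countᵇ (λ f → b ∧ occurs u f) fs + A
      ≡⟨ cong (_+ A) (cong₂ _+_ (countᵇ-∧ˡ a (occurs v) fs) (countᵇ-∧ˡ b (occurs u) fs)) ⟩
    ⟦ a ⟧ * Bᵥ + ⟦ b ⟧ * Bᵤ + A ∎
    where
    a b : Bool
    a = x ==ᶠ u
    b = x ==ᶠ v
    a⇒¬b : T a → ¬ T b
    a⇒¬b x==u x==v = u≢v (trans (sym (toWitness x==u)) (toWitness x==v))

#mapsThrough-≤ : ∀ k n w → #mapsThrough (suc k) n w ≤ suc k * n ^ k
#mapsThrough-≤ zero    n w = ≤-trans (#mapsThrough-suc 0 n w) (≤-reflexive (cong (1 +_) (*-zeroʳ n)))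
#mapsThrough-≤ (suc k) n w = begin
  #mapsThrough (suc (suc k)) n w             ≤⟨ #mapsThrough-suc (suc k) n w ⟩
  n ^ suc k + n * #mapsThrough (suc k) n w   ≤⟨ +-monoʳ-≤ (n ^ suc k) (*-monoʳ-≤ n (#mapsThrough-≤ k n w)) ⟩
  n * n ^ k + n * (suc k * n ^ k)            ≡⟨ rearrange k n (n ^ k) ⟩
  suc (suc k) * n ^ suc k                    ∎
  where
  open ≤-Reasoning
  rearrange : ∀ k n P → n * P + n * (suc k * P) ≡ suc (suc k) * (n * P)
  rearrange = solve-∀

#mapsThrough²-≤ : ∀ k n {u v} → u ≢ v → #mapsThrough² (2 + k) n u v ≤ (2 + k) * (1 + k) * n ^ k
#mapsThrough²-≤ zero n {u} {v} u≢v = begin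
  #mapsThrough² 2 n u v                                   ≤⟨ #mapsThrough²-suc 1 n u≢v ⟩
  #mapsThrough 1 n v + #mapsThrough 1 n u + n * #mapsThrough² 1 n u v
    ≤⟨ +-mono-≤ (+-mono-≤ (#mapsThrough-≤ 0 n v) (#mapsThrough-≤ 0 n u)) (*-monoʳ-≤ n A₁≤0) ⟩
  1 + 1 + n * 0                                           ≡⟨ cong (2 +_) (*-zeroʳ n) ⟩
  2                                                       ∎
  where
  open ≤-Reasoning
  A₁≤0 : #mapsThrough² 1 n u v ≤ 0
  A₁≤0 = ≤-trans (#mapsThrough²-suc 0 n u≢v) (≤-reflexive (*-zeroʳ n))
#mapsThrough²-≤ (suc k) n {u} {v} u≢v = begin
  #mapsThrough² (3 + k) n u v
    ≤⟨ #mapsThrough²-suc (2 + k) n u≢v ⟩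
  #mapsThrough (2 + k) n v + #mapsThrough (2 + k) n u + n * #mapsThrough² (2 + k) n u v
    ≤⟨ +-mono-≤ (+-mono-≤ (#mapsThrough-≤ (suc k) n v) (#mapsThrough-≤ (suc k) n u))
                (*-monoʳ-≤ n (#mapsThrough²-≤ k n u≢v)) ⟩
  (2 + k) * (n * n ^ k) + (2 + k) * (n * n ^ k) + n * ((2 + k) * (1 + k) * n ^ k)
    ≡⟨ rearrange k n (n ^ k) ⟩
  (3 + k) * (2 + k) * n ^ (1 + k) ∎
  where
  open ≤-Reasoning
  rearrange : ∀ k n P → (2 + k) * (n * P) + (2 + k) * (n * P) + n * ((2 + k) * (1 + k) * P)
                        ≡ (3 + k) * (2 + k) * (n * P)
  rearrange = solve-∀

#copiesThrough² : ∀ {h n} → RBGraph h → RBComplete n → Fin n → Fin n → ℕ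
#copiesThrough² H G u v = countᵇ (λ S → hasVertex u S ∧ hasVertex v S) (copies H G)

#copiesThrough²-≤ : ∀ {h n} (H : RBGraph h) (G : RBComplete n) u v → #copiesThrough² H G u v ≤ #mapsThrough² h n u v
#copiesThrough²-≤ {h} {n} H G u v = begin
  length (filterᵇ through (copies H G))
    ≤⟨ Unique-⊆⇒length≤ (filter⁺ (T? ∘ through) (copies-Unique H G)) ⊆images ⟩
  length (map (image H) (filterᵇ through′ (allMaps h n)))
    ≡⟨ length-map (image H) (filterᵇ through′ (allMaps h n)) ⟩
  #mapsThrough² h n u v ∎
  where
  open ≤-Reasoning
  through : Subgraph n → Bool
  through S = hasVertex u S ∧ hasVertex v S
  through′ : Vec (Fin n) h → Bool
  through′ f = occurs u f ∧ occurs v f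
  ⊆images : ∀ {S} → S ∈ filterᵇ through (copies H G) → S ∈ map (image H) (filterᵇ through′ (allMaps h n))
  ⊆images S∈ with ∈-filter⁻ (T? ∘ through) {xs = copies H G} S∈
  ... | S∈copies , uv∈S with ∈-copies⁻ H G S∈copies
  ... | f , _ , refl = ∈-map⁺ (image H) (∈-filter⁺ (T? ∘ through′) {xs = allMaps h n} (∈-allMaps f)
                         (subst T (cong₂ _∧_ (hasVertex-image H f u) (hasVertex-image H f v)) uv∈S))

-- Switching: a maximiser has nearly equal degrees

relabel : ∀ {n} → (Fin n → Fin n) → Subgraph n → Subgraph n
relabel π (V , E) = V.tabulate (lookup V ∘ π) , V.tabulate (λ a → V.tabulate (λ b → lookup (lookup E (π a)) (π b)))

hasVertex-relabel : ∀ {n} (π : Fin n → Fin n) S w → hasVertex w (relabel π S) ≡ hasVertex (π w) S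
hasVertex-relabel π (V , E) w = lookup∘tabulate (lookup V ∘ π) w

module _ {n : ℕ} {π π′ : Fin n → Fin n} (π′∘π≗id : π′ ∘ π ≗ id) (π∘π′≗id : π ∘ π′ ≗ id) where

  relabel-inverse : ∀ S → relabel π (relabel π′ S) ≡ S
  relabel-inverse (V , E) = cong₂ _,_
    (trans (tabulate-cong (λ a → trans (lookup∘tabulate _ (π a)) (cong (lookup V) (π′∘π≗id a)))) (tabulate∘lookup V))
    (trans (tabulate-cong (λ a → trans (tabulate-cong (λ b → entry a b)) (tabulate∘lookup (lookup E a)))) (tabulate∘lookup E))
    where
    entry : ∀ a b → lookup (lookup (relabel π′ (V , E) .proj₂) (π a)) (π b) ≡ lookup (lookup E a) b
    entry a b = begin
      lookup (lookup (V.tabulate _) (π a)) (π b) ≡⟨ cong (λ row → lookup row (π b)) (lookup∘tabulate _ (π a)) ⟩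
      lookup (V.tabulate _) (π b)                ≡⟨ lookup∘tabulate _ (π b) ⟩
      lookup (lookup E (π′ (π a))) (π′ (π b))    ≡⟨ cong₂ (λ a′ b′ → lookup (lookup E a′) b′) (π′∘π≗id a) (π′∘π≗id b) ⟩
      lookup (lookup E a) b                      ∎
      where open ≡-Reasoning

  image-map : ∀ {h} (H : RBGraph h) (f : Vec (Fin n) h) → image H (V.map π f) ≡ relabel π′ (image H f)
  image-map H f = cong₂ _,_
    (tabulate-cong (λ w → trans (anyFin-cong (λ i → moved i w)) (sym (lookup∘tabulate _ (π′ w)))))
    (tabulate-cong (λ w → tabulate-cong (λ w′ → trans
      (anyFin-cong (λ i → anyFin-cong (λ j → cong₂ (λ x y → x ∧ y ∧ is-just (H i j)) (moved i w) (moved j w′))))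
      (sym (trans (cong (λ row → lookup row (π′ w′)) (lookup∘tabulate _ (π′ w))) (lookup∘tabulate _ (π′ w′)))))))
    where
    moved : ∀ i w → (lookup (V.map π f) i ==ᶠ w) ≡ (lookup f i ==ᶠ π′ w)
    moved i w = trans (cong (_==ᶠ w) (lookup-map i π f)) (==ᶠ-cong-⇔ (mk⇔
      (λ πa≡w → trans (sym (π′∘π≗id _)) (cong π′ πa≡w))
      (λ a≡π′w → trans (cong π a≡π′w) (π∘π′≗id w))))

module _ {n : ℕ} where

  transpose-matchˡ : ∀ (i j : Fin n) → transpose i j i ≡ j
  transpose-matchˡ i j rewrite dec-true (i ≟ i) refl = refl

  transpose-others : ∀ {i j k : Fin n} → k ≢ i → k ≢ j → transpose i j k ≡ k
  transpose-others {i} {j} {k} k≢i k≢j rewrite dec-false (k ≟ i) k≢i | dec-false (k ≟ j) k≢j = refl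

  redirect : Fin n → Fin n → Fin n → Fin n
  redirect v u a with does (a ≟ v)
  ... | true  = u
  ... | false = a

  redirect-match : ∀ v u → redirect v u v ≡ u
  redirect-match v u rewrite dec-true (v ≟ v) refl = refl

  redirect-others : ∀ {v u a} → a ≢ v → redirect v u a ≡ a
  redirect-others {v} {u} {a} a≢v rewrite dec-false (a ≟ v) a≢v = refl

  redirect∘transpose : ∀ {u v a} → a ≢ v → redirect v u (transpose u v a) ≡ a
  redirect∘transpose {u} {v} {a} a≢v = case a ≟ u of λ where
    (yes refl) → trans (cong (redirect v u) (transpose-matchˡ u v)) (redirect-match v u)
    (no a≢u)   → trans (cong (redirect v u) (transpose-others a≢u a≢v)) (redirect-others a≢v)

module Cloning {h n} (H : RBGraph h) (G : RBComplete n) {u v : Fin n} where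

  G[v≔u] : RBComplete n
  G[v≔u] a b = G (redirect v u a) (redirect v u b)

  avoids-v : Subgraph n → Bool
  avoids-v S = not (hasVertex v S)

  has-u-avoids-v : Subgraph n → Bool
  has-u-avoids-v S = hasVertex u S ∧ not (hasVertex v S)

  private
    τ τ′ : Fin n → Fin n
    τ  = transpose u v
    τ′ = transpose v u

    τ′∘τ≗id : τ′ ∘ τ ≗ id
    τ′∘τ≗id _ = transpose-inverse v u

    τ∘τ′≗id : τ ∘ τ′ ≗ id
    τ∘τ′≗id _ = transpose-inverse u v

  avoiding-embedding : ∀ {S} → S ∈ copies H G → T (avoids-v S) →
                       ∃ λ f → Embedding H G f × image H f ≡ S × (∀ i → lookup f i ≢ v)
  avoiding-embedding S∈ v∉S with ∈-copies⁻ H G S∈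
  ... | f , e , refl = f , e , refl , λ i fᵢ≡v →
    T-not⇒¬T v∉S (subst T (sym (hasVertex-image H f v)) (occurs⁺ f i fᵢ≡v))

  ∈-copies-avoiding : ∀ {S} → S ∈ copies H G → T (avoids-v S) → S ∈ copies H G[v≔u]
  ∈-copies-avoiding S∈ v∉S with avoiding-embedding S∈ v∉S
  ... | f , e , refl , f≢v = ∈-copies⁺ H G[v≔u] (Embedding-transfer {g = f} e id
    (λ i j → cong₂ G (redirect-others (f≢v i)) (redirect-others (f≢v j))))

  ∈-copies-swapped : ∀ {S} → S ∈ copies H G → T (avoids-v S) → relabel τ′ S ∈ copies H G[v≔u]
  ∈-copies-swapped S∈ v∉S with avoiding-embedding S∈ v∉S
  ... | f , e , refl , f≢v = subst (_∈ copies H G[v≔u]) (image-map {π = τ} {τ′} τ′∘τ≗id τ∘τ′≗id H f)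
    (∈-copies⁺ H G[v≔u] (Embedding-transfer {g = τf} e collapse colours))
    where
    τf : Vec (Fin n) h
    τf = V.map τ f
    collapse : ∀ {i j} → lookup τf i ≡ lookup τf j → lookup f i ≡ lookup f j
    collapse {i} {j} eq = begin
      lookup f i          ≡⟨ τ′∘τ≗id (lookup f i) ⟨
      τ′ (τ (lookup f i)) ≡⟨ cong τ′ (trans (sym (lookup-map i τ f)) (trans eq (lookup-map j τ f))) ⟩
      τ′ (τ (lookup f j)) ≡⟨ τ′∘τ≗id (lookup f j) ⟩
      lookup f j          ∎
      where open ≡-Reasoning
    colours : ∀ i j → G[v≔u] (lookup τf i) (lookup τf j) ≡ G (lookup f i) (lookup f j)
    colours i j rewrite lookup-map i τ f | lookup-map j τ f =
      cong₂ G (redirect∘transpose (f≢v i)) (redirect∘transpose (f≢v j))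

  #copies-G[v≔u]-≥ : countᵇ avoids-v (copies H G) + countᵇ has-u-avoids-v (copies H G) ≤ #copies H G[v≔u]
  #copies-G[v≔u]-≥ = begin
    countᵇ avoids-v C + length L₂                   ≡⟨ cong (countᵇ avoids-v C +_) (length-map (relabel τ′) L₂) ⟨
    length L₁ + length (map (relabel τ′) L₂)        ≡⟨ length-++ L₁ ⟨
    length (L₁ ++ map (relabel τ′) L₂)              ≤⟨ Unique-⊆⇒length≤ unique ⊆copies ⟩
    #copies H G[v≔u]                                ∎
    where
    open ≤-Reasoning
    C L₁ L₂ : List (Subgraph n)
    C  = copies H G
    L₁ = filterᵇ avoids-v C
    L₂ = filterᵇ has-u-avoids-v C
    relabel-injective : ∀ {S S′} → relabel τ′ S ≡ relabel τ′ S′ → S ≡ S′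
    relabel-injective {S} {S′} eq = trans (sym (relabel-inverse {π = τ} {τ′} τ′∘τ≗id τ∘τ′≗id S))
      (trans (cong (relabel τ) eq) (relabel-inverse {π = τ} {τ′} τ′∘τ≗id τ∘τ′≗id S′))
    disjoint : ∀ {S} → S ∈ L₁ × S ∈ map (relabel τ′) L₂ → ⊥
    disjoint (S∈L₁ , S∈τ′L₂) with ∈-map⁻ (relabel τ′) S∈τ′L₂
    ... | S′ , S′∈L₂ , refl = T-not⇒¬T (proj₂ (∈-filter⁻ (T? ∘ avoids-v) {xs = C} S∈L₁))
      (subst T (sym (trans (hasVertex-relabel τ′ S′ v) (cong (λ w → hasVertex w S′) (transpose-matchˡ v u))))
        (proj₁ (Equivalence.to T-∧ (proj₂ (∈-filter⁻ (T? ∘ has-u-avoids-v) {xs = C} S′∈L₂)))))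
    unique : Unique (L₁ ++ map (relabel τ′) L₂)
    unique = ++⁺ (filter⁺ (T? ∘ avoids-v) (copies-Unique H G))
                 (map⁺ relabel-injective (filter⁺ (T? ∘ has-u-avoids-v) (copies-Unique H G))) disjoint
    ⊆copies : ∀ {S} → S ∈ L₁ ++ map (relabel τ′) L₂ → S ∈ copies H G[v≔u]
    ⊆copies S∈ with ∈-++⁻ L₁ S∈
    ... | inj₁ S∈L₁ = uncurry ∈-copies-avoiding (∈-filter⁻ (T? ∘ avoids-v) {xs = C} S∈L₁)
    ... | inj₂ S∈τ′L₂ with ∈-map⁻ (relabel τ′) S∈τ′L₂
    ... | S′ , S′∈L₂ , refl with ∈-filter⁻ (T? ∘ has-u-avoids-v) {xs = C} S′∈L₂
    ... | S′∈C , u∈S′∌v = ∈-copies-swapped S′∈C (proj₂ (Equivalence.to T-∧ u∈S′∌v))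

#copiesAt-≤ : ∀ {h n} {H : RBGraph h} {G : RBComplete n} → IsMaximiser H G → ∀ u v →
              #copiesAt H G u ≤ #copiesAt H G v + #copiesThrough² H G u v
#copiesAt-≤ {H = H} {G} (symmetric , maximal) u v = begin
  #copiesAt H G u                                             ≡⟨ countᵇ-split (hasVertex u) (hasVertex v) C ⟩
  #copiesThrough² H G u v + countᵇ has-u-avoids-v C           ≤⟨ +-monoʳ-≤ (#copiesThrough² H G u v) u∌v≤v ⟩
  #copiesThrough² H G u v + #copiesAt H G v                   ≡⟨ +-comm _ (#copiesAt H G v) ⟩
  #copiesAt H G v + #copiesThrough² H G u v                   ∎
  where
  open ≤-Reasoning
  open Cloning H G {u} {v}
  C : List (Subgraph _)
  C = copies H G
  u∌v≤v : countᵇ has-u-avoids-v C ≤ #copiesAt H G v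
  u∌v≤v = +-cancelˡ-≤ (countᵇ avoids-v C) _ _ (begin
    countᵇ avoids-v C + countᵇ has-u-avoids-v C   ≤⟨ #copies-G[v≔u]-≥ ⟩
    #copies H G[v≔u]                             ≤⟨ maximal G[v≔u] (λ a b → symmetric (redirect v u a) (redirect v u b)) ⟩
    #copies H G                                  ≡⟨ countᵇ-const-true C ⟨
    countᵇ (const true) C                        ≡⟨ countᵇ-split (const true) (hasVertex v) C ⟩
    #copiesAt H G v + countᵇ avoids-v C           ≡⟨ +-comm (#copiesAt H G v) _ ⟩
    countᵇ avoids-v C + #copiesAt H G v           ∎)

-- Blow-ups: a maximiser has Ω(n^h) copies

module Blowup {h} .{{_ : NonZero h}} (H : RBGraph h) (n : ℕ) where

  part : Fin n → Fin h
  part a = toℕ a mod h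

  blowup : RBComplete n
  blowup a b = fromMaybe red (H (part a) (part b))

  blowup-IsRBComplete : IsRBGraph H → IsRBComplete blowup
  blowup-IsRBComplete (H-symmetric , _) a b = cong (fromMaybe red) (H-symmetric (part a) (part b))

  module _ {m} (m*h≤n : m * h ≤ n) where

    vertex : Fin h → Fin m → Fin n
    vertex i a = fromℕ< (begin-strict
      toℕ i + toℕ a * h   <⟨ +-monoˡ-< (toℕ a * h) (toℕ<n i) ⟩
      h + toℕ a * h       ≤⟨ *-monoˡ-≤ h (toℕ<n a) ⟩
      m * h               ≤⟨ m*h≤n ⟩
      n                   ∎)
      where open ≤-Reasoning

    toℕ-vertex : ∀ i a → toℕ (vertex i a) ≡ toℕ i + toℕ a * h
    toℕ-vertex i a = toℕ-fromℕ< _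

    part-vertex : ∀ i a → part (vertex i a) ≡ i
    part-vertex i a = toℕ-injective (begin
      toℕ (toℕ (vertex i a) mod h)  ≡⟨ toℕ-fromℕ< _ ⟩
      toℕ (vertex i a) % h          ≡⟨ cong (_% h) (toℕ-vertex i a) ⟩
      (toℕ i + toℕ a * h) % h       ≡⟨ [m+kn]%n≡m%n (toℕ i) (toℕ a) h ⟩
      toℕ i % h                     ≡⟨ m<n⇒m%n≡m (toℕ<n i) ⟩
      toℕ i                         ∎)
      where open ≡-Reasoning

    vertex-injectiveʳ : ∀ i {a b} → vertex i a ≡ vertex i b → a ≡ b
    vertex-injectiveʳ i {a} {b} eq = toℕ-injective (*-cancelʳ-≡ (toℕ a) (toℕ b) h
      (+-cancelˡ-≡ (toℕ i) _ _ (trans (sym (toℕ-vertex i a)) (trans (cong toℕ eq) (toℕ-vertex i b)))))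

    layered : Vec (Fin m) h → Vec (Fin n) h
    layered g = V.tabulate (λ i → vertex i (lookup g i))

    part-layered : ∀ g i → part (lookup (layered g) i) ≡ i
    part-layered g i = trans (cong part (lookup∘tabulate _ i)) (part-vertex i (lookup g i))

    layered-Embedding : ∀ g → Embedding H blowup (layered g)
    layered-Embedding g = record
      { injective        = λ {i} {j} eq → trans (sym (part-layered g i)) (trans (cong part eq) (part-layered g j))
      ; preserves-colour = λ {i} {j} Hij →
          trans (cong (fromMaybe red) (cong₂ H (part-layered g i) (part-layered g j))) (cong (fromMaybe red) Hij)
      }

    image-layered-injective : ∀ {g g′} → image H (layered g) ≡ image H (layered g′) → g ≡ g′
    image-layered-injective {g} {g′} eq = trans (sym (tabulate∘lookup g)) (trans (tabulate-cong same) (tabulate∘lookup g′))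
      where
      same : ∀ i → lookup g i ≡ lookup g′ i
      same i with occurs⁻ (layered g′) (subst T (trans (cong (hasVertex w) eq) (hasVertex-image H (layered g′) w))
                    (subst T (sym (hasVertex-image H (layered g) w)) (occurs⁺ (layered g) i refl)))
        where
        w : Fin n
        w = lookup (layered g) i
      ... | j , g′ⱼ≡w with trans (sym (part-layered g′ j)) (trans (cong part g′ⱼ≡w) (part-layered g i))
      ... | refl = vertex-injectiveʳ i (trans (sym (lookup∘tabulate _ i)) (trans (sym g′ⱼ≡w) (lookup∘tabulate _ i)))

    #copies-blowup : m ^ h ≤ #copies H blowup
    #copies-blowup = begin
      m ^ h                                           ≡⟨ length-allMaps h m ⟨
      length (allMaps h m)                            ≡⟨ length-map (image H ∘ layered) (allMaps h m) ⟨
      length (map (image H ∘ layered) (allMaps h m))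
        ≤⟨ Unique-⊆⇒length≤ (map⁺ image-layered-injective (allMaps-Unique h m)) ⊆copies ⟩
      #copies H blowup                                ∎
      where
      open ≤-Reasoning
      ⊆copies : ∀ {S} → S ∈ map (image H ∘ layered) (allMaps h m) → S ∈ copies H blowup
      ⊆copies S∈ with ∈-map⁻ (image H ∘ layered) S∈
      ... | g , _ , refl = ∈-copies⁺ H blowup (layered-Embedding g)

n≤2*[n/h]*h : ∀ n h .{{_ : NonZero h}} → h ≤ n → n ≤ 2 * (n / h) * h
n≤2*[n/h]*h n h h≤n = begin
  n                            ≡⟨ m≡m%n+[m/n]*n n h ⟩
  n % h + n / h * h            ≤⟨ +-monoˡ-≤ (n / h * h) (<⇒≤ (m%n<n n h)) ⟩
  h + n / h * h                ≡⟨ cong (_+ n / h * h) (*-identityˡ h) ⟨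
  1 * h + n / h * h            ≤⟨ +-monoˡ-≤ (n / h * h) (*-monoˡ-≤ h (m≥n⇒m/n>0 h≤n)) ⟩
  n / h * h + n / h * h        ≡⟨ rearrange (n / h) h ⟩
  2 * (n / h) * h              ∎
  where
  open ≤-Reasoning
  rearrange : ∀ q h → q * h + q * h ≡ 2 * q * h
  rearrange = solve-∀

^-distribʳ-* : ∀ a b e → (a * b) ^ e ≡ a ^ e * b ^ e
^-distribʳ-* a b zero    = refl
^-distribʳ-* a b (suc e) = trans (cong (a * b *_) (^-distribʳ-* a b e)) (rearrange a b (a ^ e) (b ^ e))
  where
  rearrange : ∀ a b x y → a * b * (x * y) ≡ a * x * (b * y)
  rearrange = solve-∀

#copies-maximiser-≥ : ∀ {h n} .{{_ : NonZero h}} {H : RBGraph h} {G : RBComplete n} →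
  IsRBGraph H → IsMaximiser H G → h ≤ n → n ^ h ≤ (2 * h) ^ h * #copies H G
#copies-maximiser-≥ {h} {n} {H} {G} H-wf (_ , maximal) h≤n = begin
  n ^ h                                  ≤⟨ ^-monoˡ-≤ h (n≤2*[n/h]*h n h h≤n) ⟩
  (2 * m * h) ^ h                        ≡⟨ cong (_^ h) (rearrange m h) ⟩
  (2 * h * m) ^ h                        ≡⟨ ^-distribʳ-* (2 * h) m h ⟩
  (2 * h) ^ h * m ^ h                    ≤⟨ *-monoʳ-≤ ((2 * h) ^ h) (#copies-blowup m*h≤n) ⟩
  (2 * h) ^ h * #copies H blowup         ≤⟨ *-monoʳ-≤ ((2 * h) ^ h) (maximal blowup (blowup-IsRBComplete H-wf)) ⟩
  (2 * h) ^ h * #copies H G              ∎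
  where
  open ≤-Reasoning
  open Blowup H n
  m : ℕ
  m = n / h
  m*h≤n : m * h ≤ n
  m*h≤n = m/n*n≤m n h
  rearrange : ∀ m h → 2 * m * h ≡ 2 * h * m
  rearrange = solve-∀

#copiesAt-close : ∀ {k n} {H : RBGraph (2 + k)} {G : RBComplete n} → IsMaximiser H G →
                  ∀ u w → #copiesAt H G u ≤ #copiesAt H G w + (2 + k) * (1 + k) * n ^ k
#copiesAt-close {k} {n} {H} {G} maximiser u w = case u ≟ w of λ where
  (yes refl) → m≤m+n (#copiesAt H G u) _
  (no u≢w)   → ≤-trans (#copiesAt-≤ {H = H} maximiser u w)
                 (+-monoʳ-≤ (#copiesAt H G w) (≤-trans (#copiesThrough²-≤ H G u w) (#mapsThrough²-≤ k n u≢w)))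

*-≤-+ : ∀ n {a b e x} → a ≤ b + e → n * e ≤ x → n * a ≤ n * b + x
*-≤-+ n {a} {b} {e} {x} a≤b+e n*e≤x = begin
  n * a            ≤⟨ *-monoʳ-≤ n a≤b+e ⟩
  n * (b + e)      ≡⟨ *-distribˡ-+ n b e ⟩
  n * b + n * e    ≤⟨ +-monoʳ-≤ (n * b) n*e≤x ⟩
  n * b + x        ∎
  where open ≤-Reasoning

codegree-budget : ∀ k n T → n ^ (2 + k) ≤ (2 * (2 + k)) ^ (2 + k) * T →
  n * (n * ((2 + k) * (1 + k) * n ^ k)) ≤ (1 + k) * (2 * (2 + k)) ^ (2 + k) * (2 + k) * T
codegree-budget k n T n^h≤ = begin
  n * (n * ((2 + k) * (1 + k) * n ^ k))         ≡⟨ pull-out (2 + k) (1 + k) n (n ^ k) ⟩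
  (2 + k) * (1 + k) * n ^ (2 + k)               ≤⟨ *-monoʳ-≤ ((2 + k) * (1 + k)) n^h≤ ⟩
  (2 + k) * (1 + k) * ((2 * (2 + k)) ^ (2 + k) * T) ≡⟨ reorder (2 + k) (1 + k) ((2 * (2 + k)) ^ (2 + k)) T ⟩
  (1 + k) * (2 * (2 + k)) ^ (2 + k) * (2 + k) * T ∎
  where
  open ≤-Reasoning
  pull-out : ∀ a b n P → n * (n * (a * b * P)) ≡ a * b * (n * (n * P))
  pull-out = solve-∀
  reorder : ∀ a b Q T → a * b * (Q * T) ≡ b * Q * a * T
  reorder = solve-∀

module _ {k n} {H : RBGraph (2 + k)} {G : RBComplete n}
         (H-wf : IsRBGraph H) (maximiser : IsMaximiser H G) (h≤n : 2 + k ≤ n) where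

  private
    codegree-bound slack : ℕ
    codegree-bound = (2 + k) * (1 + k) * n ^ k
    slack          = (1 + k) * (2 * (2 + k)) ^ (2 + k) * (2 + k) * #copies H G

    budget : n * (n * codegree-bound) ≤ slack
    budget = codegree-budget k n (#copies H G) (#copies-maximiser-≥ H-wf maximiser h≤n)

    close : ∀ u w → #copiesAt H G u ≤ #copiesAt H G w + codegree-bound
    close = #copiesAt-close {H = H} maximiser

  #copiesAt-upper : ∀ v → n * n * #copiesAt H G v ≤ n * (2 + k) * #copies H G + slack
  #copiesAt-upper v = begin
    n * n * #copiesAt H G v                  ≡⟨ *-assoc n n (#copiesAt H G v) ⟩
    n * (n * #copiesAt H G v)                ≤⟨ *-≤-+ n (≤-trans (*-≤-∑+ (#copiesAt H G) close v)
                                                  (≤-reflexive (cong (_+ n * codegree-bound) (∑-#copiesAt H G)))) budget ⟩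
    n * ((2 + k) * #copies H G) + slack      ≡⟨ cong (_+ slack) (*-assoc n (2 + k) (#copies H G)) ⟨
    n * (2 + k) * #copies H G + slack        ∎
    where open ≤-Reasoning

  #copiesAt-lower : ∀ v → n * (2 + k) * #copies H G ≤ n * n * #copiesAt H G v + slack
  #copiesAt-lower v = begin
    n * (2 + k) * #copies H G                ≡⟨ *-assoc n (2 + k) (#copies H G) ⟩
    n * ((2 + k) * #copies H G)              ≤⟨ *-≤-+ n (≤-trans (≤-reflexive (sym (∑-#copiesAt H G)))
                                                  (∑-≤-*+ (#copiesAt H G) close v)) budget ⟩
    n * (n * #copiesAt H G v) + slack        ≡⟨ cong (_+ slack) (*-assoc n n (#copiesAt H G v)) ⟨
    n * n * #copiesAt H G v + slack          ∎
    where open ≤-Reasoning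

lemma3p3 : (h : ℕ) → 2 ≤ h →
    Σ ℕ (λ c → Σ ℕ (λ n₀ → (n : ℕ) → n₀ ≤ n →
    (H : RBGraph h) → IsRBGraph H →
    (G : RBComplete n) → IsMaximiser H G →
    (v : Fin n) →
    (n * n * #copiesAt H G v ≤ n * h * #copies H G + c * h * #copies H G)
    × (n * h * #copies H G ≤ n * n * #copiesAt H G v + c * h * #copies H G)))
lemma3p3 (suc (suc k)) (s≤s (s≤s z≤n)) = (1 + k) * (2 * (2 + k)) ^ (2 + k) , 2 + k , λ n h≤n H H-wf G maximiser v →
  #copiesAt-upper H-wf maximiser h≤n v , #copiesAt-lower H-wf maximiser h≤n v
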